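{- Let $T$ be a tree of odd order $2n+1$. If $T$ is graceful, then $T$ is semigraceful.
   Context: For natural numbers $m,s,t$ define $dc_{m}(s,t)=|s-t|$ if $|s-t|\le m/2$ and $dc_m(s,t)=m-|s-t|$ if $|s-t|\ge m/2$. A tree $T$ of order $2n+1$ is \emph{semigraceful} if its vertices can be labeled bijectively with the numbers $1,\dots,2n+1$ (label $\ell$) so that the multiset of induced edge labels $dc_{2n+1}(\ell(u),\ell(v))$, over the edges $uv$ of $T$, equals $\{1,1,2,2,\dots,n,n\}$. A tree of order $p$ is \emph{graceful} if its vertices can be labeled bijectively with $0,\dots,p-1$ so that the induced edge labels $|\ell(u)-\ell(v)|$ are pairwise distinct. -}

module Defs where

open import Data.Nat using (ℕ; zero; suc; _+_; _*_; _∸_; _≤_; ∣_-_∣)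
open import Data.Nat.Properties using (_≤?_)
open import Data.Fin using (Fin; toℕ)
open import Data.Product using (Σ; _×_; _,_; proj₁; proj₂)
open import Data.Sum using (_⊎_)
open import Data.List using (List; []; _∷_; length; map)
open import Data.List.Relation.Unary.AllPairs using (AllPairs)
open import Data.List.Relation.Unary.Unique.Propositional using (Unique)
open import Data.List.Relation.Binary.Permutation.Propositional using (_↭_)
open import Data.List.Membership.Propositional using (_∈_)
open import Relation.Nullary using (¬_; yes; no)
open import Relation.Binary.PropositionalEquality using (_≡_)
open import Relation.Binary.Construct.Closure.ReflexiveTransitive using (Star)
open import Function.Definitions using (Bijective)

-- An (undirected) edge between vertices of Fin p, stored as an ordered pair.
Edge : ℕ → Set
Edge p = Fin p × Fin p

SameEdge : ∀ {p} → Edge p → Edge p → Set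
SameEdge (a , b) (c , d) = (a ≡ c × b ≡ d) ⊎ (a ≡ d × b ≡ c)

Adj : ∀ {p} → List (Edge p) → Fin p → Fin p → Set
Adj es u v = ((u , v) ∈ es) ⊎ ((v , u) ∈ es)

record Tree (p : ℕ) : Set where
  field
    edges     : List (Edge p)
    loopless  : ∀ {u v} → (u , v) ∈ edges → ¬ (u ≡ v)
    noMulti   : AllPairs (λ e f → ¬ SameEdge e f) edges
    connected : ∀ u v → Star (Adj edges) u v
    edgeCount : length edges + 1 ≡ p
open Tree public

Graceful : ∀ {p} → Tree p → Set
Graceful {p} T =
  Σ (Fin p → Fin p) λ ℓ →
    Bijective _≡_ _≡_ ℓ ×
    Unique (map (λ e → ∣ toℕ (ℓ (proj₁ e)) - toℕ (ℓ (proj₂ e)) ∣) (edges T))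

dc : ℕ → ℕ → ℕ → ℕ
dc m s t with 2 * ∣ s - t ∣ ≤? m
... | yes _ = ∣ s - t ∣
... | no  _ = m ∸ ∣ s - t ∣

doubled : ℕ → List ℕ
doubled zero    = []
doubled (suc n) = suc n ∷ suc n ∷ doubled n

Semigraceful : (n : ℕ) → Tree (suc (2 * n)) → Set
Semigraceful n T =
  Σ (Fin (suc (2 * n)) → Fin (suc (2 * n))) λ ℓ →
    Bijective _≡_ _≡_ ℓ ×
    (map (λ e → dc (suc (2 * n)) (suc (toℕ (ℓ (proj₁ e)))) (suc (toℕ (ℓ (proj₂ e)))))
         (edges T) ↭ doubled n)

{-# OPTIONS --safe #-}
module Submission where

-- A graceful labelling of a tree with 2n + 1 vertices gives its 2n edges the
-- distinct labels 1, …, 2n, i.e. each of them exactly once. Shifting all vertex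
-- labels up by one preserves differences, and dc_{2n+1} turns a difference d into
-- min (d, 2n+1 − d), which sends the complementary pair {k, 2n+1 − k} to k, k.

open import Defs
open import Data.Nat using (ℕ; zero; suc; _*_; _+_; _∸_; _≤_; _<_; s≤s⁻¹; ∣_-_∣)
open import Data.Nat.Properties
open import Data.Fin using (Fin; toℕ)
open import Data.Fin.Properties using (toℕ-injective; toℕ<n)
open import Data.Product using (_,_; proj₁; proj₂)
open import Data.Sum using (_⊎_; inj₁; inj₂; map₂)
open import Data.List using (List; []; _∷_; _++_; length; map)
open import Data.List.Properties using (map-cong; map-∘; length-map)
open import Data.List.Relation.Unary.All as All using ()
open import Data.List.Relation.Unary.AllPairs using (_∷_)
open import Data.List.Relation.Unary.Any using (here; there)
open import Data.List.Relation.Unary.Unique.Propositional using (Unique)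
open import Data.List.Relation.Binary.Subset.Propositional using (_⊆_)
open import Data.List.Relation.Binary.Permutation.Propositional
  using (_↭_; prep; ↭-refl; ↭-trans; ↭-sym; module PermutationReasoning)
open import Data.List.Relation.Binary.Permutation.Propositional.Properties
  using (shift; ↭-length; map⁺)
open import Data.List.Membership.Propositional using (_∈_)
open import Data.List.Membership.Propositional.Properties
  using (∈-∃++; ∈-++⁻; ∈-++⁺ˡ; ∈-++⁺ʳ; ∈-map⁻)
open import Function using (_∘_)
open import Function.Definitions using (Injective)
open import Relation.Nullary using (yes; no; contradiction)
open import Relation.Binary.PropositionalEquality
  using (_≡_; _≢_; refl; sym; trans; cong; cong₂; subst; subst₂; module ≡-Reasoning)

module _ {a} {A : Set a} where

  ∈-++-∷⁻ : ∀ {x y : A} xs ys → y ∈ xs ++ x ∷ ys → y ≢ x → y ∈ xs ++ ys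
  ∈-++-∷⁻ xs ys y∈ y≢x with ∈-++⁻ xs y∈
  ... | inj₁ y∈xs         = ∈-++⁺ˡ y∈xs
  ... | inj₂ (here y≡x)   = contradiction y≡x y≢x
  ... | inj₂ (there y∈ys) = ∈-++⁺ʳ xs y∈ys

  unique-⊆⇒↭ : ∀ {xs ys : List A} → Unique xs → xs ⊆ ys → length ys ≤ length xs → xs ↭ ys
  unique-⊆⇒↭ {[]}     {[]}    _ _ _  = ↭-refl
  unique-⊆⇒↭ {[]}     {_ ∷ _} _ _ ()
  unique-⊆⇒↭ {x ∷ xs} (x∉xs ∷ xs!) xs⊆ys |ys|≤|xs|
    with ys₁ , ys₂ , refl ← ∈-∃++ (xs⊆ys (here refl)) =
    ↭-trans (prep x (unique-⊆⇒↭ xs! xs⊆ys₁++ys₂ |ys₁++ys₂|≤|xs|)) (↭-sym (shift x ys₁ ys₂))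
    where
    xs⊆ys₁++ys₂ : xs ⊆ ys₁ ++ ys₂
    xs⊆ys₁++ys₂ y∈xs = ∈-++-∷⁻ ys₁ ys₂ (xs⊆ys (there y∈xs)) (All.lookup x∉xs y∈xs ∘ sym)

    |ys₁++ys₂|≤|xs| : length (ys₁ ++ ys₂) ≤ length xs
    |ys₁++ys₂|≤|xs| = s≤s⁻¹ (subst (_≤ length (x ∷ xs)) (↭-length (shift x ys₁ ys₂)) |ys|≤|xs|)

cyclicNorm : ℕ → ℕ → ℕ
cyclicNorm m d with 2 * d ≤? m
... | yes _ = d
... | no  _ = m ∸ d

dc≡cyclicNorm : ∀ m s t → dc m s t ≡ cyclicNorm m ∣ s - t ∣
dc≡cyclicNorm m s t with 2 * ∣ s - t ∣ ≤? m
... | yes _ = refl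
... | no  _ = refl

cyclicNorm-≤ : ∀ {m d} → 2 * d ≤ m → cyclicNorm m d ≡ d
cyclicNorm-≤ {m} {d} 2d≤m with 2 * d ≤? m
... | yes _    = refl
... | no  2d≰m = contradiction 2d≤m 2d≰m

m<2*[m∸d] : ∀ {m d} → 2 * d < m → m < 2 * (m ∸ d)
m<2*[m∸d] {m} {d} 2d<m = begin-strict
  m                   <⟨ m+n≤o⇒m≤o∸n (suc m) m+1+2d≤m+m ⟩
  2 * m ∸ 2 * d       ≡⟨ *-distribˡ-∸ 2 m d ⟨
  2 * (m ∸ d)         ∎
  where
  open ≤-Reasoning
  m+1+2d≤m+m : suc m + 2 * d ≤ 2 * m
  m+1+2d≤m+m = subst₂ _≤_ (+-suc m (2 * d)) (cong (m +_) (sym (+-identityʳ m)))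
                      (+-monoʳ-≤ m 2d<m)

cyclicNorm-∸ : ∀ {m d} → 2 * d < m → cyclicNorm m (m ∸ d) ≡ d
cyclicNorm-∸ {m} {d} 2d<m with 2 * (m ∸ d) ≤? m
... | yes 2[m∸d]≤m = contradiction 2[m∸d]≤m (<⇒≱ (m<2*[m∸d] {m} {d} 2d<m))
... | no  _        = m∸[m∸n]≡n (≤-trans (m≤m+n d (d + 0)) (<⇒≤ 2d<m))

complementPairs : ℕ → ℕ → List ℕ
complementPairs m zero    = []
complementPairs m (suc k) = suc k ∷ m ∸ suc k ∷ complementPairs m k

length-complementPairs : ∀ m k → length (complementPairs m k) ≡ 2 * k
length-complementPairs m zero    = refl
length-complementPairs m (suc k) =
  trans (cong (2 +_) (length-complementPairs m k)) (sym (*-suc 2 k))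

map-cyclicNorm-complementPairs : ∀ {m} k → 2 * k < m →
                                 map (cyclicNorm m) (complementPairs m k) ≡ doubled k
map-cyclicNorm-complementPairs zero    _      = refl
map-cyclicNorm-complementPairs (suc k) 2k+2<m =
  cong₂ _∷_ (cyclicNorm-≤ (<⇒≤ 2k+2<m))
    (cong₂ _∷_ (cyclicNorm-∸ 2k+2<m)
      (map-cyclicNorm-complementPairs k (<-trans (*-monoʳ-< 2 (n<1+n k)) 2k+2<m)))

∈-complementPairs : ∀ {m k d} → k ≤ m → 0 < d → d < m → d ≤ k ⊎ m ∸ k ≤ d →
                    d ∈ complementPairs m k
∈-complementPairs {k = zero} _ 0<d _   (inj₁ d≤0) = contradiction d≤0 (<⇒≱ 0<d)
∈-complementPairs {k = zero} _ _   d<m (inj₂ m≤d) = contradiction m≤d (<⇒≱ d<m)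
∈-complementPairs {m} {suc k} {d} 1+k≤m 0<d d<m d∈ends with d ≟ suc k | d ≟ m ∸ suc k
... | yes refl | _        = here refl
... | no _     | yes refl = there (here refl)
... | no d≢1+k | no d≢m∸[1+k] =
  there (there (∈-complementPairs (≤-trans (n≤1+n k) 1+k≤m) 0<d d<m d∈inner))
  where
  d∈inner : d ≤ k ⊎ m ∸ k ≤ d
  d∈inner = Data.Sum.map (λ d≤1+k → s≤s⁻¹ (≤∧≢⇒< d≤1+k d≢1+k))
                         (λ m∸[1+k]≤d → subst (_≤ d) (sym (+-∸-assoc 1 1+k≤m))
                                          (≤∧≢⇒< m∸[1+k]≤d (d≢m∸[1+k] ∘ sym)))
                         d∈ends

m∸n≡1+n : ∀ n → suc (2 * n) ∸ n ≡ suc n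
m∸n≡1+n n = begin
  suc (n + (n + 0)) ∸ n   ≡⟨ cong (_∸ n) (+-suc n (n + 0)) ⟨
  n + suc (n + 0) ∸ n     ≡⟨ m+n∸m≡n n (suc (n + 0)) ⟩
  suc (n + 0)             ≡⟨ cong suc (+-identityʳ n) ⟩
  suc n                   ∎
  where open ≡-Reasoning

complementPairs-cover : ∀ {n d} → 0 < d → d < suc (2 * n) → d ∈ complementPairs (suc (2 * n)) n
complementPairs-cover {n} {d} 0<d d<m =
  ∈-complementPairs (m≤n⇒m≤1+n (m≤m+n n (n + 0))) 0<d d<m
    (map₂ (subst (_≤ d) (sym (m∸n≡1+n n))) (≤-<-connex d n))

edgeLabel : ∀ {p} → (Fin p → Fin p) → Edge p → ℕ
edgeLabel ℓ e = ∣ toℕ (ℓ (proj₁ e)) - toℕ (ℓ (proj₂ e)) ∣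

edgeLabel<order : ∀ {p} (ℓ : Fin p → Fin p) e → edgeLabel ℓ e < p
edgeLabel<order ℓ (u , v) =
  ≤-<-trans (∣m-n∣≤m⊔n (toℕ (ℓ u)) (toℕ (ℓ v))) (⊔-pres-<m (toℕ<n (ℓ u)) (toℕ<n (ℓ v)))

edgeLabel-positive : ∀ {p} (T : Tree p) {ℓ : Fin p → Fin p} → Injective _≡_ _≡_ ℓ →
                     ∀ {e} → e ∈ edges T → 0 < edgeLabel ℓ e
edgeLabel-positive T ℓ-inj e∈T =
  n≢0⇒n>0 (loopless T e∈T ∘ ℓ-inj ∘ toℕ-injective ∘ ∣m-n∣≡0⇒m≡n)

dc-suc≡cyclicNorm-edgeLabel : ∀ {p} m (ℓ : Fin p → Fin p) e →
                              dc m (suc (toℕ (ℓ (proj₁ e)))) (suc (toℕ (ℓ (proj₂ e))))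
                                ≡ cyclicNorm m (edgeLabel ℓ e)
dc-suc≡cyclicNorm-edgeLabel m ℓ (u , v) = dc≡cyclicNorm m (suc (toℕ (ℓ u))) (suc (toℕ (ℓ v)))

gracefulLabels↭ : ∀ {p} (T : Tree p) {ℓ : Fin p → Fin p} {ys : List ℕ} →
                  Injective _≡_ _≡_ ℓ → Unique (map (edgeLabel ℓ) (edges T)) →
                  (∀ {d} → 0 < d → d < p → d ∈ ys) → length ys + 1 ≡ p →
                  map (edgeLabel ℓ) (edges T) ↭ ys
gracefulLabels↭ T {ℓ} {ys} ℓ-inj distinct covers |ys|+1≡p =
  unique-⊆⇒↭ distinct labels⊆ys (≤-reflexive |ys|≡|labels|)
  where
  labels⊆ys : map (edgeLabel ℓ) (edges T) ⊆ ys
  labels⊆ys d∈ with e , e∈T , refl ← ∈-map⁻ (edgeLabel ℓ) d∈ =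
    covers (edgeLabel-positive T ℓ-inj e∈T) (edgeLabel<order ℓ e)

  |ys|≡|labels| : length ys ≡ length (map (edgeLabel ℓ) (edges T))
  |ys|≡|labels| = trans (+-cancelʳ-≡ 1 _ _ (trans |ys|+1≡p (sym (edgeCount T))))
                        (sym (length-map (edgeLabel ℓ) (edges T)))

mainTheorem1 : (n : ℕ) (T : Tree (suc (2 * n))) → Graceful T → Semigraceful n T
mainTheorem1 n T (ℓ , ℓ-bij , distinct) = ℓ , ℓ-bij , (begin
  map (λ e → dc m (suc (toℕ (ℓ (proj₁ e)))) (suc (toℕ (ℓ (proj₂ e))))) (edges T)
    ≡⟨ trans (map-cong (dc-suc≡cyclicNorm-edgeLabel m ℓ) (edges T)) (map-∘ (edges T)) ⟩
  map (cyclicNorm m) (map (edgeLabel ℓ) (edges T))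
    ↭⟨ map⁺ (cyclicNorm m) (gracefulLabels↭ T (proj₁ ℓ-bij) distinct complementPairs-cover
                              |complementPairs|+1≡m) ⟩
  map (cyclicNorm m) (complementPairs m n)
    ≡⟨ map-cyclicNorm-complementPairs n (n<1+n (2 * n)) ⟩
  doubled n ∎)
  where
  open PermutationReasoning
  m : ℕ
  m = suc (2 * n)

  |complementPairs|+1≡m : length (complementPairs m n) + 1 ≡ m
  |complementPairs|+1≡m = trans (cong (_+ 1) (length-complementPairs m n)) (+-comm (2 * n) 1)
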